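{- Let $(P,\leq,{}',M,R,0,1)$ be an operator residuated poset satisfying operator divisibility, and assume that $M(x,y)=L(U(x,y'),y)$ and $R(x,y)=LU(x',L(x,y))$ for all $x,y\in P$. Then $(P,\leq,{}',0,1)$ is a generalized orthomodular poset.
   Context: For a poset $(P,\leq)$ and $A\subseteq P$, $L(A)=\{x\in P\mid x\leq a\text{ for all }a\in A\}$ and $U(A)=\{x\in P\mid a\leq x\text{ for all }a\in A\}$; we write $L(a,b)=L(\{a,b\})$, $L(a,B)=L(\{a\}\cup B)$, $L(A,B)=L(A\cup B)$, $LU(A)=L(U(A))$, etc. A unary operation $'$ on a poset is an antitone involution if $x''=x$ and $x\leq y$ implies $y'\leq x'$; on a bounded poset it is a complementation if $L(x,x')=\{0\}$ and $U(x,x')=\{1\}$. An orthoposet is a bounded poset $(P,\leq,{}',0,1)$ with an antitone involution $'$ which is a complementation. A generalized orthomodular poset is an orthoposet such that for all $x,y\in P$, $x\leq y$ implies $U(y)=U(x,L(x',y))$. An operator residuated poset is a tuple $(P,\leq,{}',M,R,0,1)$ where $(P,\leq,0,1)$ is a bounded poset, $'$ is a unary antitone operation on $P$ (i.e. $x\leq y$ implies $y'\leq x'$), and $M,R:P^2\to 2^P$ satisfy for all $x,y,z\in P$: (i) $M(x,y)\subseteq L(z)$ if and only if $L(x)\subseteq R(y,z)$; (ii) $R(x,0)=L(x')$; (iii) $R(x,x'')=R(x'',x)=P$. It satisfies operator divisibility if $x\leq y$ implies $L(y,U(R(y,x)))=L(x)$ for all $x,y\in P$. -}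

module Defs where

open import Level using (Level; _⊔_)
open import Data.Product using (_×_)
open import Relation.Binary.Bundles using (Poset)
open import Relation.Unary using (Pred; _⊆_; _≐_; _∪_) renaming (U to Full)

-- Subsets of a poset are predicates; equality of subsets is mutual inclusion (_≐_).
module PosetSets {c ℓ₁ ℓ₂ : Level} (P : Poset c ℓ₁ ℓ₂) where
  open Poset P renaming (Carrier to C)

  ⟦_⟧ : C → Pred C ℓ₁
  ⟦ a ⟧ = λ x → x ≈ a

  L : {ℓ : Level} → Pred C ℓ → Pred C (c ⊔ ℓ₂ ⊔ ℓ)
  L A = λ x → ∀ a → A a → x ≤ a

  U : {ℓ : Level} → Pred C ℓ → Pred C (c ⊔ ℓ₂ ⊔ ℓ)
  U A = λ x → ∀ a → A a → a ≤ x

record OperatorResiduatedPoset {c ℓ₁ ℓ₂ : Level} (P : Poset c ℓ₁ ℓ₂) (ℓM : Level)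
       : Set (Level.suc (c ⊔ ℓ₁ ⊔ ℓ₂ ⊔ ℓM)) where
  open Poset P renaming (Carrier to C)
  open PosetSets P
  field
    𝟎 𝟏 : C
    𝟎-least : ∀ x → 𝟎 ≤ x
    𝟏-greatest : ∀ x → x ≤ 𝟏
    _′ : C → C
    ′-antitone : ∀ {x y} → x ≤ y → y ′ ≤ x ′
    M R : C → C → Pred C ℓM
    residuation₁ : ∀ x y z → M x y ⊆ L ⟦ z ⟧ → L ⟦ x ⟧ ⊆ R y z
    residuation₂ : ∀ x y z → L ⟦ x ⟧ ⊆ R y z → M x y ⊆ L ⟦ z ⟧
    R-𝟎 : ∀ x → R x 𝟎 ≐ L ⟦ x ′ ⟧
    R-′′ʳ : ∀ x → R x ((x ′) ′) ≐ Full
    R-′′ˡ : ∀ x → R ((x ′) ′) x ≐ Full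

module _ {c ℓ₁ ℓ₂ ℓM : Level} {P : Poset c ℓ₁ ℓ₂} (O : OperatorResiduatedPoset P ℓM) where
  open Poset P renaming (Carrier to C)
  open PosetSets P
  open OperatorResiduatedPoset O

  OperatorDivisible : Set _
  OperatorDivisible = ∀ x y → x ≤ y → L (⟦ y ⟧ ∪ U (R y x)) ≐ L ⟦ x ⟧

  HasStandardMR : Set _
  HasStandardMR =
    (∀ x y → M x y ≐ L (U (⟦ x ⟧ ∪ ⟦ y ′ ⟧) ∪ ⟦ y ⟧)) ×
    (∀ x y → R x y ≐ L (U (⟦ x ′ ⟧ ∪ L (⟦ x ⟧ ∪ ⟦ y ⟧))))

record IsGeneralizedOrthomodularPoset {c ℓ₁ ℓ₂ : Level} (P : Poset c ℓ₁ ℓ₂)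
       (_′ : Poset.Carrier P → Poset.Carrier P) (𝟎 𝟏 : Poset.Carrier P)
       : Set (c ⊔ ℓ₁ ⊔ ℓ₂) where
  open Poset P renaming (Carrier to C)
  open PosetSets P
  field
    𝟎-least : ∀ x → 𝟎 ≤ x
    𝟏-greatest : ∀ x → x ≤ 𝟏
    involutive : ∀ x → (x ′) ′ ≈ x
    antitone : ∀ {x y} → x ≤ y → y ′ ≤ x ′
    complement-L : ∀ x → L (⟦ x ⟧ ∪ ⟦ x ′ ⟧) ≐ ⟦ 𝟎 ⟧
    complement-U : ∀ x → U (⟦ x ⟧ ∪ ⟦ x ′ ⟧) ≐ ⟦ 𝟏 ⟧
    orthomodular : ∀ x y → x ≤ y → U ⟦ y ⟧ ≐ U (⟦ x ⟧ ∪ L (⟦ x ′ ⟧ ∪ ⟦ y ⟧))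

module Submission where

open import Defs
open import Level using (Level)
open import Relation.Binary.Bundles using (Poset)
open import Data.Product using (_,_; proj₁; proj₂)
open import Data.Sum using (inj₁; inj₂)
open import Data.Unit using (tt)
open import Relation.Unary using (Pred; _∪_; _⊆_; _≐_) renaming (U to Full)

-- Involutivity comes from condition (iii): R(y,y'') = R(y'',y) = P forces, by residuation,
-- y ≤ y'' and y'' ≤ y, since y ∈ M(1,y) = L(U(1,y'),y).  Complementation comes from (ii):
-- a common lower bound of x and x' lies in M(x',x), which residuation against R(x,0) = L(x'')
-- places below 0.  For orthomodularity, let x ≤ y and u be an upper bound of x and L(x',y);
-- then u' lies in R(x',y') = LU(x'',L(x',y')), hence in L(x', U(R(x',y'))), which operator
-- divisibility at y' ≤ x' identifies with L(y'); so u' ≤ y' and y ≤ u.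

module Cones {c ℓ₁ ℓ₂ : Level} (P : Poset c ℓ₁ ℓ₂) where
  open Poset P renaming (Carrier to C)
  open PosetSets P

  private variable
    ℓ : Level
    a b x : C
    A B : Pred C ℓ

  L-⟦⟧ : x ≤ a → L ⟦ a ⟧ x
  L-⟦⟧ x≤a b b≈a = ≤-respʳ-≈ (Eq.sym b≈a) x≤a

  U-⟦⟧ : a ≤ x → U ⟦ a ⟧ x
  U-⟦⟧ a≤x b b≈a = ≤-respˡ-≈ (Eq.sym b≈a) a≤x

  L-⟦⟧⁻ : L ⟦ a ⟧ x → x ≤ a
  L-⟦⟧⁻ l = l _ Eq.refl

  U-⟦⟧⁻ : U ⟦ a ⟧ x → a ≤ x
  U-⟦⟧⁻ u = u _ Eq.refl

  L-∪ : L A x → L B x → L (A ∪ B) x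
  L-∪ lA lB a (inj₁ a∈A) = lA a a∈A
  L-∪ lA lB a (inj₂ a∈B) = lB a a∈B

  U-∪ : U A x → U B x → U (A ∪ B) x
  U-∪ uA uB a (inj₁ a∈A) = uA a a∈A
  U-∪ uA uB a (inj₂ a∈B) = uB a a∈B

  L-pair : x ≤ a → x ≤ b → L (⟦ a ⟧ ∪ ⟦ b ⟧) x
  L-pair x≤a x≤b = L-∪ (L-⟦⟧ x≤a) (L-⟦⟧ x≤b)

  L-∪-≤ˡ : L (⟦ a ⟧ ∪ B) x → x ≤ a
  L-∪-≤ˡ l = l _ (inj₁ Eq.refl)

  L-∪-≤ʳ : L (A ∪ ⟦ b ⟧) x → x ≤ b
  L-∪-≤ʳ l = l _ (inj₂ Eq.refl)

  U-∪-≥ˡ : U (⟦ a ⟧ ∪ B) x → a ≤ x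
  U-∪-≥ˡ u = u _ (inj₁ Eq.refl)

  U-∪-≥ʳ : U (A ∪ ⟦ b ⟧) x → b ≤ x
  U-∪-≥ʳ u = u _ (inj₂ Eq.refl)

  L≐⟦least⟧ : (∀ z → b ≤ z) → (∀ {z} → L A z → z ≤ b) → L A ≐ ⟦ b ⟧
  L≐⟦least⟧ least below =
    (λ {z} z∈LA → antisym (below z∈LA) (least z)) ,
    (λ z≈b a _ → ≤-respˡ-≈ (Eq.sym z≈b) (least a))

  U≐⟦greatest⟧ : (∀ z → z ≤ b) → (∀ {z} → U A z → b ≤ z) → U A ≐ ⟦ b ⟧
  U≐⟦greatest⟧ greatest above =
    (λ {z} z∈UA → antisym (greatest z) (above z∈UA)) ,
    (λ z≈b a _ → ≤-respʳ-≈ (Eq.sym z≈b) (greatest a))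

module AntitoneInvolution {c ℓ₁ ℓ₂ : Level} (P : Poset c ℓ₁ ℓ₂) (_′ : Poset.Carrier P → Poset.Carrier P)
    (antitone : ∀ {x y} → Poset._≤_ P x y → Poset._≤_ P (y ′) (x ′))
    (involutive : ∀ x → Poset._≈_ P ((x ′) ′) x) where
  open Poset P renaming (Carrier to C)
  open PosetSets P
  open Cones P

  private variable
    x y : C

  ′-shiftˡ : x ′ ≤ y → y ′ ≤ x
  ′-shiftˡ x′≤y = ≤-respʳ-≈ (involutive _) (antitone x′≤y)

  ′-shiftʳ : x ≤ y ′ → y ≤ x ′
  ′-shiftʳ x≤y′ = ≤-respˡ-≈ (involutive _) (antitone x≤y′)

  ′-reflects-≤ : x ′ ≤ y ′ → y ≤ x
  ′-reflects-≤ x′≤y′ = ≤-respˡ-≈ (involutive _) (′-shiftˡ x′≤y′)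

  module _ (𝟎 𝟏 : C) (𝟎-least : ∀ x → 𝟎 ≤ x) (𝟏-greatest : ∀ x → x ≤ 𝟏) where

    U-complement-≥𝟏 : (∀ {x z} → L (⟦ x ⟧ ∪ ⟦ x ′ ⟧) z → z ≤ 𝟎) →
                      ∀ {x u} → U (⟦ x ⟧ ∪ ⟦ x ′ ⟧) u → 𝟏 ≤ u
    U-complement-≥𝟏 L-complement {u = u} u∈U = trans 𝟏≤𝟎′ (′-shiftˡ u′≤𝟎)
      where
      𝟏≤𝟎′ : 𝟏 ≤ 𝟎 ′
      𝟏≤𝟎′ = ′-shiftʳ (𝟎-least (𝟏 ′))

      u′≤𝟎 : u ′ ≤ 𝟎
      u′≤𝟎 = L-complement (L-pair (′-shiftˡ (U-∪-≥ʳ u∈U)) (antitone (U-∪-≥ˡ u∈U)))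

module OperatorResiduated {c ℓ₁ ℓ₂ ℓM : Level} {P : Poset c ℓ₁ ℓ₂}
    (O : OperatorResiduatedPoset P ℓM) where
  open Poset P renaming (Carrier to C)
  open PosetSets P
  open OperatorResiduatedPoset O

  M⊆L-of-R-full : ∀ {y z} → R y z ≐ Full → ∀ x → M x y ⊆ L ⟦ z ⟧
  M⊆L-of-R-full R-full x = residuation₂ x _ _ (λ _ → proj₂ R-full tt)

  M-′-below-𝟎 : ∀ {x w} → M (x ′) x w → w ≤ 𝟎
  M-′-below-𝟎 {x} w∈M = residuation₂ (x ′) x 𝟎 (proj₂ (R-𝟎 x)) w∈M 𝟎 Eq.refl

module StandardOperators {c ℓ₁ ℓ₂ ℓM : Level} {P : Poset c ℓ₁ ℓ₂}
    (O : OperatorResiduatedPoset P ℓM) where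
  open PosetSets P
  open OperatorResiduatedPoset O

  StandardM : Set _
  StandardM = ∀ x y → M x y ≐ L (U (⟦ x ⟧ ∪ ⟦ y ′ ⟧) ∪ ⟦ y ⟧)

  StandardR : Set _
  StandardR = ∀ x y → R x y ≐ L (U (⟦ x ′ ⟧ ∪ L (⟦ x ⟧ ∪ ⟦ y ⟧)))

module FromStandardM {c ℓ₁ ℓ₂ ℓM : Level} {P : Poset c ℓ₁ ℓ₂}
    (O : OperatorResiduatedPoset P ℓM) (M-standard : StandardOperators.StandardM O) where
  open Poset P
  open PosetSets P
  open Cones P
  open OperatorResiduatedPoset O
  open OperatorResiduated O

  L-pair⊆M : ∀ x y → L (⟦ x ⟧ ∪ ⟦ y ⟧) ⊆ M x y
  L-pair⊆M x y w∈L = proj₂ (M-standard x y)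
    (L-∪ (λ t t∈U → trans (L-∪-≤ˡ w∈L) (U-∪-≥ˡ t∈U)) (L-⟦⟧ (L-∪-≤ʳ w∈L)))

  ≤-of-R-full : ∀ {y z} → R y z ≐ Full → y ≤ z
  ≤-of-R-full {y} R-full =
    L-⟦⟧⁻ (M⊆L-of-R-full R-full 𝟏 (L-pair⊆M 𝟏 y (L-pair (𝟏-greatest y) refl)))

  involutive : ∀ x → (x ′) ′ ≈ x
  involutive x = antisym (≤-of-R-full (R-′′ˡ x)) (≤-of-R-full (R-′′ʳ x))

  L-complement-≤𝟎 : ∀ {x z} → L (⟦ x ⟧ ∪ ⟦ x ′ ⟧) z → z ≤ 𝟎
  L-complement-≤𝟎 z∈L = M-′-below-𝟎 (L-pair⊆M _ _ (L-pair (L-∪-≤ʳ z∈L) (L-∪-≤ˡ z∈L)))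

module Orthomodularity {c ℓ₁ ℓ₂ ℓM : Level} {P : Poset c ℓ₁ ℓ₂}
    (O : OperatorResiduatedPoset P ℓM) (divisible : OperatorDivisible O)
    (M-standard : StandardOperators.StandardM O) (R-standard : StandardOperators.StandardR O) where
  open Poset P renaming (Carrier to C)
  open PosetSets P
  open Cones P
  open OperatorResiduatedPoset O
  open FromStandardM O M-standard using (involutive)
  open AntitoneInvolution P _′ ′-antitone involutive

  module _ {x y : C} (x≤y : x ≤ y) where

    U-⊆-U-orthomodular : U ⟦ y ⟧ ⊆ U (⟦ x ⟧ ∪ L (⟦ x ′ ⟧ ∪ ⟦ y ⟧))
    U-⊆-U-orthomodular {u} u∈U = U-∪ (U-⟦⟧ (trans x≤y y≤u)) (λ b b∈L → trans (L-∪-≤ʳ b∈L) y≤u)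
      where
      y≤u : y ≤ u
      y≤u = U-⟦⟧⁻ u∈U

    U-orthomodular-⊆-U : U (⟦ x ⟧ ∪ L (⟦ x ′ ⟧ ∪ ⟦ y ⟧)) ⊆ U ⟦ y ⟧
    U-orthomodular-⊆-U {u} u∈U = U-⟦⟧ (′-reflects-≤ u′≤y′)
      where
      -- an upper bound t of x'' and L(x',y') = L(y') has t' ∈ L(x',y), so t' ≤ u
      u′∈R : R (x ′) (y ′) (u ′)
      u′∈R = proj₂ (R-standard (x ′) (y ′)) λ t t∈U →
        ′-shiftˡ (u∈U (t ′) (inj₂ (L-pair
          (′-antitone (≤-respˡ-≈ (involutive x) (U-∪-≥ˡ t∈U)))
          (′-shiftˡ (t∈U (y ′) (inj₂ (L-pair (′-antitone x≤y) refl)))))))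

      u′≤y′ : u ′ ≤ y ′
      u′≤y′ = L-⟦⟧⁻ (proj₁ (divisible (y ′) (x ′) (′-antitone x≤y))
        (L-∪ (L-⟦⟧ (′-antitone (U-∪-≥ˡ u∈U))) (λ b b∈U → b∈U (u ′) u′∈R)))

    orthomodular : U ⟦ y ⟧ ≐ U (⟦ x ⟧ ∪ L (⟦ x ′ ⟧ ∪ ⟦ y ⟧))
    orthomodular = U-⊆-U-orthomodular , U-orthomodular-⊆-U

mainTheorem4 : {c ℓ₁ ℓ₂ ℓM : Level} (P : Poset c ℓ₁ ℓ₂)
    (O : OperatorResiduatedPoset P ℓM) →
    OperatorDivisible O →
    HasStandardMR O →
    IsGeneralizedOrthomodularPoset P (OperatorResiduatedPoset._′ O)
      (OperatorResiduatedPoset.𝟎 O) (OperatorResiduatedPoset.𝟏 O)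
mainTheorem4 P O divisible std = record
  { 𝟎-least = 𝟎-least
  ; 𝟏-greatest = 𝟏-greatest
  ; involutive = involutive
  ; antitone = ′-antitone
  ; complement-L = λ _ → L≐⟦least⟧ 𝟎-least L-complement-≤𝟎
  ; complement-U = λ _ → U≐⟦greatest⟧ 𝟏-greatest
      (U-complement-≥𝟏 𝟎 𝟏 𝟎-least 𝟏-greatest L-complement-≤𝟎)
  ; orthomodular = λ _ _ → Orthomodularity.orthomodular O divisible (proj₁ std) (proj₂ std)
  }
  where
  open OperatorResiduatedPoset O
  open Cones P
  open FromStandardM O (proj₁ std)
  open AntitoneInvolution P _′ ′-antitone involutive
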